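{- For each integer $m\ge 1$ let $C_m=\det C^{(m)}$, where $C^{(m)}$ is the $m\times m$ matrix with entries $C^{(m)}_{ij}=1$ if $-2\le j-i\le 1$ and $0$ otherwise. For an integer $n\ge 6$ let $L^{(n)}$ be the $n\times n$ matrix defined as follows: the first row has $L^{(n)}_{11}=1$, $L^{(n)}_{1,n-1}=1$ and all other entries $0$; the second row has $L^{(n)}_{21}=L^{(n)}_{22}=1$, $L^{(n)}_{2n}=1$ and all other entries $0$; rows $i=3,\dots,n$ have $L^{(n)}_{ij}=1$ if $-2\le j-i\le 1$ and $0$ otherwise. Let $L_n=\det L^{(n)}$. Then $$L_n = C_{n-2}\bigl(1+(-1)^n\bigr) + (-1)^n\bigl(C_{n-3}-2C_{n-4}+C_{n-5}\bigr) + 1.$$ -}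

module Defs where

open import Data.Nat using (ℕ; zero; suc; _≤ᵇ_; _≡ᵇ_; _∸_)
  renaming (_+_ to _+ℕ_)
open import Data.Bool using (Bool; true; false; _∧_; _∨_; if_then_else_)
open import Data.Fin using (Fin; zero; suc; toℕ; punchIn)
open import Data.Integer using (ℤ; +_; -_; _+_; _*_; _^_)

Matrix : ℕ → Set
Matrix n = Fin n → Fin n → ℤ

∑ : ∀ {n} → (Fin n → ℤ) → ℤ
∑ {zero}  f = + 0
∑ {suc n} f = f zero + ∑ (λ i → f (suc i))

minor : ∀ {n} → Matrix (suc n) → Fin (suc n) → Matrix n
minor M j r c = M (suc r) (punchIn j c)

det : ∀ {n} → Matrix n → ℤ
det {zero}  M = + 1
det {suc n} M = ∑ (λ j → ((- (+ 1)) ^ toℕ j) * (M zero j * det (minor M j)))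

𝟙 : Bool → ℤ
𝟙 true  = + 1
𝟙 false = + 0

-- Band condition -2 ≤ j - i ≤ 1, i.e. i ≤ j + 2 and j ≤ i + 1
-- (invariant under shifting both indices, so 0-based indexing is fine).
band : ℕ → ℕ → Bool
band i j = (i ≤ᵇ j +ℕ 2) ∧ (j ≤ᵇ i +ℕ 1)

Cmat : (m : ℕ) → Matrix m
Cmat m i j = 𝟙 (band (toℕ i) (toℕ j))

C : ℕ → ℤ
C m = det (Cmat m)

-- The matrix L^(n), written with 0-based indices:
-- paper row 1 = index 0: entries at columns 1 and n-1 (0-based 0 and n-2);
-- paper row 2 = index 1: entries at columns 1,2,n (0-based 0,1,n-1);
-- paper rows 3..n = indices 2..n-1: band.
Lrow : ℕ → ℕ → ℕ → Bool
Lrow n zero j = (j ≡ᵇ 0) ∨ (j ≡ᵇ (n ∸ 2))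
Lrow n (suc zero) j = (j ≡ᵇ 0) ∨ (j ≡ᵇ 1) ∨ (j ≡ᵇ (n ∸ 1))
Lrow n (suc (suc i)) j = band (suc (suc i)) j

Lmat : (n : ℕ) → Matrix n
Lmat n i j = 𝟙 (Lrow n (toℕ i) (toℕ j))

L : ℕ → ℤ
L n = det (Lmat n)

module Submission where

-- Three families of band determinants occur: C_m (ones on -2 ≤ c - r ≤ 1),
-- the transposed band, and the transposed band whose last column is cut
-- down to its bottom two entries.  As the arrays are invariant under
-- shifting both indices, expanding along first rows shows that each family
-- satisfies u(m+3) = u(m+2) - u(m+1) + u(m), whose solutions have period 4;
-- so each family is determined by three initial values.
-- Expanding L⁽ⁿ⁾ along its first row and both resulting minors along theirs
-- gives, with s = (-1)ⁿ and C′ the capped family,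
--   L_n = C_{n-2} + s Cᵀ_{n-2} + s (C′_{n-2} - C′_{n-3} + s).
-- The theorem is then an identity between 4-periodic sequences, checked for
-- the four residues of n modulo 4.

open import Defs
open import Data.Nat using (_≟_; ℕ; zero; suc; _<_; _≤_; z≤n; s≤s; _≡ᵇ_; _≤ᵇ_; _<ᵇ_; _∸_) renaming (_+_ to _+ℕ_)
open import Function using (_∘_)
import Data.Nat.Properties as ℕ
open import Data.Integer using (ℤ; +_; -_; _+_; _-_; _*_; _^_)
import Data.Integer.Properties as ℤ
open import Data.Integer.Tactic.RingSolver using (solve-∀)
open import Data.Fin using (Fin; zero; suc; toℕ; punchIn)
open import Data.Fin.Properties using (toℕ<n)
open import Data.Bool using (Bool; true; false; _∧_; _∨_; if_then_else_)
open import Data.Sum using (inj₁; inj₂)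
open import Data.Bool.Properties using (if-eta)
open import Relation.Binary.PropositionalEquality
open import Relation.Nullary.Decidable using (dec-true; dec-false)
open ≡-Reasoning

-- An array is an infinite integer matrix; we study determinants of its
-- leading square blocks, which lets one array describe a whole family of
-- matrices and lets minors be written as arrays again.
Array : Set
Array = ℕ → ℕ → ℤ

punch : ℕ → ℕ → ℕ
punch zero    c       = suc c
punch (suc j) zero    = zero
punch (suc j) (suc c) = suc (punch j c)

delete : Array → ℕ → Array
delete f j r c = f (suc r) (punch j c)

sumTo : ℕ → (ℕ → ℤ) → ℤ
sumTo zero    h = + 0
sumTo (suc n) h = h 0 + sumTo n (λ j → h (suc j))

sign : ℕ → ℤ
sign j = (- (+ 1)) ^ j

toℕ-punchIn : ∀ {n} (j : Fin (suc n)) (c : Fin n) → toℕ (punchIn j c) ≡ punch (toℕ j) (toℕ c)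
toℕ-punchIn zero    c       = refl
toℕ-punchIn (suc j) zero    = refl
toℕ-punchIn (suc j) (suc c) = cong suc (toℕ-punchIn j c)

∑-cong : ∀ {n} {f g : Fin n → ℤ} → (∀ i → f i ≡ g i) → ∑ f ≡ ∑ g
∑-cong {zero}  e = refl
∑-cong {suc n} e = cong₂ _+_ (e zero) (∑-cong (λ i → e (suc i)))

∑-sumTo : ∀ n (h : ℕ → ℤ) → ∑ {n} (λ j → h (toℕ j)) ≡ sumTo n h
∑-sumTo zero    h = refl
∑-sumTo (suc n) h = cong (λ t → h 0 + t) (∑-sumTo n (λ j → h (suc j)))

det-cong : ∀ {n} (M N : Matrix n) → (∀ i j → M i j ≡ N i j) → det M ≡ det N
det-cong {zero}  M N e = refl
det-cong {suc n} M N e = ∑-cong λ j →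
  cong₂ (λ a b → sign (toℕ j) * (a * b)) (e zero j)
        (det-cong (minor M j) (minor N j) (λ r c → e (suc r) (punchIn j c)))

-- The determinant of the leading m × m block is kept opaque, so that it is
-- only ever unfolded through the Laplace expansion below.
opaque
  det↾ : ℕ → Array → ℤ
  det↾ m f = det {m} (λ i j → f (toℕ i) (toℕ j))

term : Array → ℕ → ℕ → ℤ
term f m j = sign j * (f 0 j * det↾ m (delete f j))

opaque
  unfolding det↾

  det↾-det : ∀ m f → det↾ m f ≡ det {m} (λ i j → f (toℕ i) (toℕ j))
  det↾-det m f = refl

  det↾-cong : ∀ m {f g : Array} → (∀ r c → r < m → c < m → f r c ≡ g r c) → det↾ m f ≡ det↾ m g
  det↾-cong m {f} {g} e = det-cong {m} _ _ (λ i j → e (toℕ i) (toℕ j) (toℕ<n i) (toℕ<n j))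

  det↾-laplace : ∀ m f → det↾ (suc m) f ≡ sumTo (suc m) (term f m)
  det↾-laplace m f = trans
    (∑-cong {suc m} λ j → cong (λ x → sign (toℕ j) * (f 0 (toℕ j) * x))
       (det-cong {m} _ _ λ r c → cong (f (suc (toℕ r))) (toℕ-punchIn j c)))
    (∑-sumTo (suc m) (term f m))

sum-zero : ∀ n h → (∀ j → j < n → h j ≡ + 0) → sumTo n h ≡ + 0
sum-zero zero    h e = refl
sum-zero (suc n) h e = cong₂ _+_ (e 0 (s≤s z≤n)) (sum-zero n (λ j → h (suc j)) (λ j j<n → e (suc j) (s≤s j<n)))

sum-prefix : ∀ k n h → (∀ j → h (k +ℕ j) ≡ + 0) → sumTo (k +ℕ n) h ≡ sumTo k h
sum-prefix zero    n h e = sum-zero n h (λ j _ → e j)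
sum-prefix (suc k) n h e = cong (λ t → h 0 + t) (sum-prefix k n (λ j → h (suc j)) e)

sum-single : ∀ n h p → p < n → (∀ j → j < n → j ≢ p → h j ≡ + 0) → sumTo n h ≡ h p
sum-single (suc n) h zero _ e = begin
  h 0 + sumTo n (λ j → h (suc j)) ≡⟨ cong (λ t → h 0 + t) (sum-zero n _ λ j j<n → e (suc j) (s≤s j<n) λ ()) ⟩
  h 0 + + 0                       ≡⟨ ℤ.+-identityʳ (h 0) ⟩
  h 0                             ∎
sum-single (suc n) h (suc p) (s≤s p<n) e = begin
  h 0 + sumTo n (λ j → h (suc j)) ≡⟨ cong₂ _+_ (e 0 (s≤s z≤n) λ ()) (sum-single n _ p p<n λ j j<n j≢p → e (suc j) (s≤s j<n) (j≢p ∘ ℕ.suc-injective)) ⟩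
  + 0 + h (suc p)                 ≡⟨ ℤ.+-identityˡ (h (suc p)) ⟩
  h (suc p)                       ∎

term-entry-zero : ∀ f m j → f 0 j ≡ + 0 → term f m j ≡ + 0
term-entry-zero f m j e rewrite e = ℤ.*-zeroʳ (sign j)

term-minor-zero : ∀ f m j → det↾ m (delete f j) ≡ + 0 → term f m j ≡ + 0
term-minor-zero f m j e rewrite e | ℤ.*-zeroʳ (f 0 j) = ℤ.*-zeroʳ (sign j)

term-entry-one : ∀ f m j → f 0 j ≡ + 1 → term f m j ≡ sign j * det↾ m (delete f j)
term-entry-one f m j e rewrite e = cong (sign j *_) (ℤ.*-identityˡ _)

det↾-zeroColumn : ∀ m f → (∀ r → f r 0 ≡ + 0) → det↾ (suc m) f ≡ + 0
det↾-zeroColumn m f e = trans (det↾-laplace m f) (sum-zero (suc m) (term f m) (vanish m))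
  where
  vanish : ∀ m j → j < suc m → term f m j ≡ + 0
  vanish m       zero    _                = term-entry-zero f m 0 (e 0)
  vanish zero    (suc j) (s≤s ())
  vanish (suc m) (suc j) _                =
    term-minor-zero f (suc m) (suc j) (det↾-zeroColumn m (delete f (suc j)) (λ r → e (suc r)))

det↾-unitPivot : ∀ m f → f 0 0 ≡ + 1 → (∀ r → f (suc r) 0 ≡ + 0) →
                 det↾ (suc m) f ≡ det↾ m (delete f 0)
det↾-unitPivot m f one zeros = begin
  det↾ (suc m) f                                   ≡⟨ det↾-laplace m f ⟩
  term f m 0 + sumTo m (λ j → term f m (suc j))    ≡⟨ cong₂ _+_ (term-entry-one f m 0 one) (sum-zero m _ (vanish m)) ⟩
  sign 0 * det↾ m (delete f 0) + + 0               ≡⟨ ℤ.+-identityʳ _ ⟩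
  sign 0 * det↾ m (delete f 0)                     ≡⟨ ℤ.*-identityˡ _ ⟩
  det↾ m (delete f 0)                              ∎
  where
  vanish : ∀ m j → j < m → term f m (suc j) ≡ + 0
  vanish (suc m) j _ = term-minor-zero f (suc m) (suc j) (det↾-zeroColumn m (delete f (suc j)) zeros)

det↾-row₂ : ∀ m f → f 0 0 ≡ + 1 → f 0 1 ≡ + 1 → (∀ j → f 0 (2 +ℕ j) ≡ + 0) →
            det↾ (2 +ℕ m) f ≡ det↾ (suc m) (delete f 0) - det↾ (suc m) (delete f 1)
det↾-row₂ m f e₀ e₁ rest = begin
  det↾ (2 +ℕ m) f                              ≡⟨ det↾-laplace (suc m) f ⟩
  sumTo (2 +ℕ m) t                             ≡⟨ sum-prefix 2 m t (λ j → term-entry-zero f (suc m) (2 +ℕ j) (rest j)) ⟩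
  t 0 + (t 1 + + 0)                            ≡⟨ cong₂ (λ a b → a + (b + + 0)) (term-entry-one f (suc m) 0 e₀) (term-entry-one f (suc m) 1 e₁) ⟩
  sign 0 * d 0 + (sign 1 * d 1 + + 0)          ≡⟨ simplify (d 0) (d 1) ⟩
  d 0 - d 1                                    ∎
  where
  t = term f (suc m)
  d = λ j → det↾ (suc m) (delete f j)
  simplify : ∀ a b → + 1 * a + (- (+ 1) * b + + 0) ≡ a - b
  simplify = solve-∀

det↾-row₃ : ∀ m f → f 0 0 ≡ + 1 → f 0 1 ≡ + 1 → f 0 2 ≡ + 1 → (∀ j → f 0 (3 +ℕ j) ≡ + 0) →
            det↾ (3 +ℕ m) f ≡ det↾ (2 +ℕ m) (delete f 0) - det↾ (2 +ℕ m) (delete f 1) + det↾ (2 +ℕ m) (delete f 2)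
det↾-row₃ m f e₀ e₁ e₂ rest = begin
  det↾ (3 +ℕ m) f                                    ≡⟨ det↾-laplace (2 +ℕ m) f ⟩
  sumTo (3 +ℕ m) t                                   ≡⟨ sum-prefix 3 m t (λ j → term-entry-zero f (2 +ℕ m) (3 +ℕ j) (rest j)) ⟩
  t 0 + (t 1 + (t 2 + + 0))                          ≡⟨ cong₂ _+_ (term-entry-one f _ 0 e₀) (cong₂ (λ a b → a + (b + + 0)) (term-entry-one f _ 1 e₁) (term-entry-one f _ 2 e₂)) ⟩
  sign 0 * d 0 + (sign 1 * d 1 + (sign 2 * d 2 + + 0)) ≡⟨ simplify (d 0) (d 1) (d 2) ⟩
  d 0 - d 1 + d 2                                    ∎
  where
  t = term f (2 +ℕ m)
  d = λ j → det↾ (2 +ℕ m) (delete f j)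
  simplify : ∀ a b c → + 1 * a + (- (+ 1) * b + (+ 1 * c + + 0)) ≡ a - b + c
  simplify = solve-∀

det↾-row-0p : ∀ m f q → q < m → f 0 0 ≡ + 1 → f 0 (suc q) ≡ + 1 →
              (∀ j → j < suc m → j ≢ 0 → j ≢ suc q → f 0 j ≡ + 0) →
              det↾ (suc m) f ≡ det↾ m (delete f 0) + sign (suc q) * det↾ m (delete f (suc q))
det↾-row-0p m f q q<m e₀ eₚ rest = begin
  det↾ (suc m) f                            ≡⟨ det↾-laplace m f ⟩
  t 0 + sumTo m (λ j → t (suc j))           ≡⟨ cong (λ x → t 0 + x) (sum-single m _ q q<m vanish) ⟩
  t 0 + t (suc q)                           ≡⟨ cong₂ _+_ (term-entry-one f m 0 e₀) (term-entry-one f m (suc q) eₚ) ⟩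
  sign 0 * d 0 + sign (suc q) * d (suc q)   ≡⟨ cong (_+ sign (suc q) * d (suc q)) (ℤ.*-identityˡ (d 0)) ⟩
  d 0 + sign (suc q) * d (suc q)            ∎
  where
  t = term f m
  d = λ j → det↾ m (delete f j)
  vanish : ∀ j → j < m → j ≢ q → t (suc j) ≡ + 0
  vanish j j<m j≢q = term-entry-zero f m (suc j) (rest (suc j) (s≤s j<m) (λ ()) (j≢q ∘ ℕ.suc-injective))

det↾-row-01p : ∀ m f q → q < m → f 0 0 ≡ + 1 → f 0 1 ≡ + 1 → f 0 (2 +ℕ q) ≡ + 1 →
               (∀ j → j < 2 +ℕ m → j ≢ 0 → j ≢ 1 → j ≢ 2 +ℕ q → f 0 j ≡ + 0) →
               det↾ (2 +ℕ m) f ≡ det↾ (suc m) (delete f 0) - det↾ (suc m) (delete f 1)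
                                 + sign (2 +ℕ q) * det↾ (suc m) (delete f (2 +ℕ q))
det↾-row-01p m f q q<m e₀ e₁ eₚ rest = begin
  det↾ (2 +ℕ m) f                                    ≡⟨ det↾-laplace (suc m) f ⟩
  t 0 + (t 1 + sumTo m (λ j → t (2 +ℕ j)))           ≡⟨ cong (λ x → t 0 + (t 1 + x)) (sum-single m _ q q<m vanish) ⟩
  t 0 + (t 1 + t p)                                  ≡⟨ cong₂ _+_ (term-entry-one f _ 0 e₀) (cong₂ _+_ (term-entry-one f _ 1 e₁) (term-entry-one f _ p eₚ)) ⟩
  sign 0 * d 0 + (sign 1 * d 1 + sign p * d p)       ≡⟨ simplify (d 0) (d 1) (sign p * d p) ⟩
  d 0 - d 1 + sign p * d p                           ∎
  where
  p = 2 +ℕ q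
  t = term f (suc m)
  d = λ j → det↾ (suc m) (delete f j)
  vanish : ∀ j → j < m → j ≢ q → t (2 +ℕ j) ≡ + 0
  vanish j j<m j≢q = term-entry-zero f (suc m) (2 +ℕ j)
    (rest (2 +ℕ j) (s≤s (s≤s j<m)) (λ ()) (λ ()) (j≢q ∘ ℕ.suc-injective ∘ ℕ.suc-injective))
  simplify : ∀ a b c → + 1 * a + (- (+ 1) * b + c) ≡ a - b + c
  simplify = solve-∀

cycle4 : ℤ → ℤ → ℤ → ℤ → ℕ → ℤ
cycle4 a b c d zero                      = a
cycle4 a b c d (suc zero)                = b
cycle4 a b c d (suc (suc zero))          = c
cycle4 a b c d (suc (suc (suc zero)))    = d
cycle4 a b c d (suc (suc (suc (suc m)))) = cycle4 a b c d m

ind4 : (P : ℕ → Set) → P 0 → P 1 → P 2 → P 3 → (∀ m → P m → P (4 +ℕ m)) → ∀ m → P m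
ind4 P p₀ p₁ p₂ p₃ step zero                      = p₀
ind4 P p₀ p₁ p₂ p₃ step (suc zero)                = p₁
ind4 P p₀ p₁ p₂ p₃ step (suc (suc zero))          = p₂
ind4 P p₀ p₁ p₂ p₃ step (suc (suc (suc zero)))    = p₃
ind4 P p₀ p₁ p₂ p₃ step (suc (suc (suc (suc m)))) = step m (ind4 P p₀ p₁ p₂ p₃ step m)

-- Its
-- characteristic polynomial x³ - x² + x - 1 = (x - 1)(x² + 1) has only
-- fourth roots of unity as roots, so every solution has period 4.
Recurrence : (ℕ → ℤ) → Set
Recurrence u = ∀ m → u (3 +ℕ m) ≡ u (2 +ℕ m) - u (1 +ℕ m) + u m

recurrence⇒period4 : ∀ u → Recurrence u → ∀ m → u (4 +ℕ m) ≡ u m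
recurrence⇒period4 u rec m = begin
  u (4 +ℕ m)                                                  ≡⟨ rec (suc m) ⟩
  u (3 +ℕ m) - u (2 +ℕ m) + u (1 +ℕ m)                        ≡⟨ cong (λ x → x - u (2 +ℕ m) + u (1 +ℕ m)) (rec m) ⟩
  u (2 +ℕ m) - u (1 +ℕ m) + u m - u (2 +ℕ m) + u (1 +ℕ m)     ≡⟨ cancel (u (2 +ℕ m)) (u (1 +ℕ m)) (u m) ⟩
  u m                                                         ∎
  where
  cancel : ∀ a b c → a - b + c - a + b ≡ c
  cancel = solve-∀

recurrence-solution : ∀ u a b c → Recurrence u → u 0 ≡ a → u 1 ≡ b → u 2 ≡ c →
                      ∀ m → u m ≡ cycle4 a b c (c - b + a) m
recurrence-solution u a b c rec u₀ u₁ u₂ =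
  ind4 (λ m → u m ≡ cycle4 a b c (c - b + a) m) u₀ u₁ u₂ u₃
       (λ m eq → trans (recurrence⇒period4 u rec m) eq)
  where
  u₃ : u 3 ≡ c - b + a
  u₃ = trans (rec 0) (cong₂ _+_ (cong₂ _-_ u₂ u₁) u₀)

sign-cycle : ∀ m → sign m ≡ cycle4 (+ 1) (- (+ 1)) (+ 1) (- (+ 1)) m
sign-cycle = ind4 _ refl refl refl refl
  (λ m eq → trans (trans (ℤ.^-distribˡ-+-* (- (+ 1)) 4 m) (ℤ.*-identityˡ (sign m))) eq)

-- Boolean ≤ by structural recursion.  Unlike _≤ᵇ_ it reduces on symbolic
-- successors, so that the band arrays below are invariant under shifting
-- both indices by definition.
leq : ℕ → ℕ → Bool
leq zero    n       = true
leq (suc m) zero    = false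
leq (suc m) (suc n) = leq m n

inBand : ℕ → ℕ → Bool
inBand i j = leq i (suc (suc j)) ∧ leq j (suc i)

leq≡<ᵇ : ∀ m n → (m <ᵇ n) ≡ leq (suc m) n
leq≡<ᵇ m       zero    = refl
leq≡<ᵇ zero    (suc n) = refl
leq≡<ᵇ (suc m) (suc n) = leq≡<ᵇ m n

leq≡≤ᵇ : ∀ m n → (m ≤ᵇ n) ≡ leq m n
leq≡≤ᵇ zero    n = refl
leq≡≤ᵇ (suc m) n = leq≡<ᵇ m n

band≡inBand : ∀ i j → band i j ≡ inBand i j
band≡inBand i j rewrite leq≡≤ᵇ i (j +ℕ 2) | leq≡≤ᵇ j (i +ℕ 1) | ℕ.+-comm j 2 | ℕ.+-comm i 1 = refl

Band : Array
Band r c = 𝟙 (inBand r c)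

bandDet : ℕ → ℤ
bandDet m = det↾ m Band

C≡bandDet : ∀ m → C m ≡ bandDet m
C≡bandDet m = trans (det-cong {m} _ _ (λ i j → cong 𝟙 (band≡inBand (toℕ i) (toℕ j)))) (sym (det↾-det m Band))

bandDet-recurrence : Recurrence bandDet
bandDet-recurrence m = begin
  det↾ (3 +ℕ m) Band                              ≡⟨ det↾-row₂ (suc m) Band refl refl (λ _ → refl) ⟩
  bandDet (2 +ℕ m) - det↾ (2 +ℕ m) Band₁          ≡⟨ cong (λ x → bandDet (2 +ℕ m) - x) (det↾-row₂ m Band₁ refl refl (λ _ → refl)) ⟩
  bandDet (2 +ℕ m) - (bandDet (1 +ℕ m) - det↾ (1 +ℕ m) Band₂) ≡⟨ cong (λ x → bandDet (2 +ℕ m) - (bandDet (1 +ℕ m) - x)) (det↾-unitPivot m Band₂ refl (λ _ → refl)) ⟩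
  bandDet (2 +ℕ m) - (bandDet (1 +ℕ m) - bandDet m) ≡⟨ regroup (bandDet (2 +ℕ m)) (bandDet (1 +ℕ m)) (bandDet m) ⟩
  bandDet (2 +ℕ m) - bandDet (1 +ℕ m) + bandDet m ∎
  where
  Band₁ = delete Band 1
  Band₂ = delete Band₁ 1
  regroup : ∀ a b c → a - (b - c) ≡ a - b + c
  regroup = solve-∀

bandDet-closed : ∀ m → bandDet m ≡ cycle4 (+ 1) (+ 1) (+ 0) (+ 0) m
bandDet-closed = recurrence-solution bandDet (+ 1) (+ 1) (+ 0) bandDet-recurrence
  (det↾-det 0 Band) (det↾-det 1 Band) (det↾-det 2 Band)

-- The transposed band: ones exactly on the diagonals -1 ≤ c - r ≤ 2.  Its
-- determinants satisfy the same recurrence, through the two minors X and Y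
-- obtained by deleting the second and third column; both have a unit pivot
-- over a zero column, and deleting it gives Bandᵀ and X respectively.
Bandᵀ : Array
Bandᵀ r c = Band (suc r) c

bandᵀDet : ℕ → ℤ
bandᵀDet m = det↾ m Bandᵀ

bandᵀDet-recurrence : Recurrence bandᵀDet
bandᵀDet-recurrence m = begin
  det↾ (3 +ℕ m) Bandᵀ                                  ≡⟨ det↾-row₃ m Bandᵀ refl refl refl (λ _ → refl) ⟩
  bandᵀDet (2 +ℕ m) - det↾ (2 +ℕ m) X + det↾ (2 +ℕ m) Y ≡⟨ cong₂ (λ x y → bandᵀDet (2 +ℕ m) - x + y) (det↾-unitPivot (suc m) X refl (λ _ → refl)) (det↾-unitPivot (suc m) Y refl (λ _ → refl)) ⟩
  bandᵀDet (2 +ℕ m) - bandᵀDet (1 +ℕ m) + det↾ (1 +ℕ m) X ≡⟨ cong (λ x → bandᵀDet (2 +ℕ m) - bandᵀDet (1 +ℕ m) + x) (det↾-unitPivot m X refl (λ _ → refl)) ⟩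
  bandᵀDet (2 +ℕ m) - bandᵀDet (1 +ℕ m) + bandᵀDet m   ∎
  where
  X = delete Bandᵀ 1
  Y = delete Bandᵀ 2

bandᵀDet-closed : ∀ m → bandᵀDet m ≡ cycle4 (+ 1) (+ 1) (+ 0) (+ 0) m
bandᵀDet-closed = recurrence-solution bandᵀDet (+ 1) (+ 1) (+ 0) bandᵀDet-recurrence
  (det↾-det 0 Bandᵀ) (det↾-det 1 Bandᵀ) (det↾-det 2 Bandᵀ)

-- capLast M f: replace column M - 1 of f by the column whose only ones are
-- in rows M - 2 and M - 1 of the leading M-block.
capLast : ℕ → Array → Array
capLast M f r c = if suc c ≡ᵇ M then 𝟙 (leq M (suc (suc r))) else f r c

punch≡ᵇ : ∀ j M c → j < M → (punch j c ≡ᵇ M) ≡ (suc c ≡ᵇ M)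
punch≡ᵇ zero    M             c       _         = refl
punch≡ᵇ (suc j) (suc (suc M)) zero    _         = refl
punch≡ᵇ (suc j) (suc M)       (suc c) (s≤s j<M) = punch≡ᵇ j M c j<M

delete-capLast : ∀ M f j → j < M → ∀ r c → delete (capLast (suc M) f) j r c ≡ capLast M (delete f j) r c
delete-capLast M f j j<M r c =
  cong (λ b → if b then 𝟙 (leq M (suc (suc r))) else delete f j r c) (punch≡ᵇ j M c j<M)

det↾-capLast-unitPivot : ∀ M f → f 0 0 ≡ + 1 → (∀ r → f (suc r) 0 ≡ + 0) →
                         det↾ (2 +ℕ M) (capLast (2 +ℕ M) f) ≡ det↾ (suc M) (capLast (suc M) (delete f 0))
det↾-capLast-unitPivot M f one zeros = trans (det↾-unitPivot (suc M) _ one zeros)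
  (det↾-cong (suc M) (λ r c _ _ → delete-capLast (suc M) f 0 (s≤s z≤n) r c))

cappedDet : ℕ → ℤ
cappedDet m = det↾ m (capLast m Bandᵀ)

cappedDet-recurrence : Recurrence (λ m → cappedDet (suc m))
cappedDet-recurrence m = begin
  det↾ (4 +ℕ m) F                                                    ≡⟨ det↾-row₃ (suc m) F refl refl refl (λ j → if-eta (j ≡ᵇ m)) ⟩
  det↾ (3 +ℕ m) (delete F 0) - det↾ (3 +ℕ m) (delete F 1) + det↾ (3 +ℕ m) (delete F 2)
    ≡⟨ cong₂ (λ x y → cappedDet (3 +ℕ m) - x + y) (capped-minor 1 (s≤s (s≤s z≤n))) (capped-minor 2 (s≤s (s≤s (s≤s z≤n)))) ⟩
  cappedDet (3 +ℕ m) - det↾ (3 +ℕ m) (capLast (3 +ℕ m) X) + det↾ (3 +ℕ m) (capLast (3 +ℕ m) Y)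
    ≡⟨ cong₂ (λ x y → cappedDet (3 +ℕ m) - x + y) (det↾-capLast-unitPivot (suc m) X refl (λ _ → refl))
             (trans (det↾-capLast-unitPivot (suc m) Y refl (λ _ → refl)) (det↾-capLast-unitPivot m X refl (λ _ → refl))) ⟩
  cappedDet (3 +ℕ m) - cappedDet (2 +ℕ m) + cappedDet (1 +ℕ m)       ∎
  where
  F = capLast (4 +ℕ m) Bandᵀ
  X = delete Bandᵀ 1
  Y = delete Bandᵀ 2
  capped-minor : ∀ j → j < 3 +ℕ m → det↾ (3 +ℕ m) (delete F j) ≡ det↾ (3 +ℕ m) (capLast (3 +ℕ m) (delete Bandᵀ j))
  capped-minor j j<M = det↾-cong (3 +ℕ m) (λ r c _ _ → delete-capLast (3 +ℕ m) Bandᵀ j j<M r c)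

cappedDet-closed : ∀ m → cappedDet (suc m) ≡ cycle4 (+ 1) (+ 0) (- (+ 1)) (+ 0) m
cappedDet-closed = recurrence-solution (λ m → cappedDet (suc m)) (+ 1) (+ 0) (- (+ 1)) cappedDet-recurrence
  (det↾-det 1 (capLast 1 Bandᵀ)) (det↾-det 2 (capLast 2 Bandᵀ)) (det↾-det 3 (capLast 3 Bandᵀ))

UnitUpper : Array
UnitUpper r c = Band (suc (suc r)) c

det↾-UnitUpper : ∀ m → det↾ m UnitUpper ≡ + 1
det↾-UnitUpper zero    = det↾-det 0 UnitUpper
det↾-UnitUpper (suc m) = trans (det↾-unitPivot m UnitUpper refl (λ _ → refl)) (det↾-UnitUpper m)

punch-below : ∀ j c → c < j → punch j c ≡ c
punch-below (suc j) zero    _         = refl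
punch-below (suc j) (suc c) (s≤s c<j) = cong suc (punch-below j c c<j)

punch-self : ∀ p → punch p p ≡ suc p
punch-self zero    = refl
punch-self (suc p) = cong suc (punch-self p)

leq-true : ∀ m n → m ≤ n → leq m n ≡ true
leq-true zero    n       _         = refl
leq-true (suc m) (suc n) (s≤s m≤n) = leq-true m n m≤n

-- Band rows read with column M of the (M+1)-block deleted form the capped
-- transposed band: the former column M + 1 becomes the capped last column.
band-capLast : ∀ M r c → r < M → c < M → Band (suc (suc r)) (punch M (suc c)) ≡ capLast M Bandᵀ r c
band-capLast M r c r<M c<M with ℕ.m≤n⇒m<n∨m≡n c<M
... | inj₁ c+1<M = begin
  Band (suc (suc r)) (punch M (suc c))  ≡⟨ cong (Band (suc (suc r))) (punch-below M (suc c) c+1<M) ⟩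
  Bandᵀ r c                             ≡⟨ cong (λ b → if b then 𝟙 (leq M (suc (suc r))) else Bandᵀ r c) (dec-false (suc c ≟ M) (ℕ.<⇒≢ c+1<M)) ⟨
  capLast M Bandᵀ r c                   ∎
... | inj₂ refl = begin
  Band (suc (suc r)) (punch (suc c) (suc c)) ≡⟨ cong (Band (suc (suc r))) (punch-self (suc c)) ⟩
  𝟙 (leq r (suc (suc c)) ∧ leq c (suc r))    ≡⟨ cong (λ b → 𝟙 (b ∧ leq c (suc r))) (leq-true r (suc (suc c)) r≤c+2) ⟩
  𝟙 (leq c (suc r))                          ≡⟨ cong (λ b → if b then 𝟙 (leq c (suc r)) else Bandᵀ r c) (dec-true (suc c ≟ suc c) refl) ⟨
  capLast (suc c) Bandᵀ r c                  ∎
  where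
  r≤c+2 : r ≤ suc (suc c)
  r≤c+2 = ℕ.≤-trans (ℕ.≤-pred r<M) (ℕ.m≤n+m c 2)

Larr : ℕ → Array
Larr n r c = 𝟙 (Lrow n r c)

Larr-band : ∀ n r c → Larr n (suc (suc r)) c ≡ Band (suc (suc r)) c
Larr-band n r c = cong 𝟙 (band≡inBand (suc (suc r)) c)

lhsForm : ℤ → ℤ → ℤ → ℤ → ℤ → ℤ
lhsForm c cᵀ x y s = c + s * cᵀ + s * (x - y + s)

rhsForm : ℤ → ℤ → ℤ → ℤ → ℤ → ℤ
rhsForm c₂ c₃ c₄ c₅ s = c₂ * (+ 1 + s) + s * (c₃ - + 2 * c₄ + c₅) + + 1

lhsForm-cong : ∀ {a a′ b b′ c c′ d d′ e e′} → a ≡ a′ → b ≡ b′ → c ≡ c′ → d ≡ d′ → e ≡ e′ →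
               lhsForm a b c d e ≡ lhsForm a′ b′ c′ d′ e′
lhsForm-cong refl refl refl refl refl = refl

rhsForm-cong : ∀ {a a′ b b′ c c′ d d′ e e′} → a ≡ a′ → b ≡ b′ → c ≡ c′ → d ≡ d′ → e ≡ e′ →
               rhsForm a b c d e ≡ rhsForm a′ b′ c′ d′ e′
rhsForm-cong refl refl refl refl refl = refl

L≡det↾ : ∀ n → L n ≡ det↾ n (Larr n)
L≡det↾ n = sym (det↾-det n (Larr n))

-- Expansion of L_n for n = k + 4 along its first row (ones at columns 0 and
-- P = n - 2), then of both minors along their first rows: the minor A of
-- column 0 splits into C_P and the transposed band, the minor B of column P
-- into two capped transposed bands and a unit upper triangular block.
module Expansion (k : ℕ) where
  K P n : ℕ
  K = suc k
  P = suc K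
  n = suc (suc P)

  s : ℤ
  s = sign P

  row₀-P : Larr n 0 P ≡ + 1
  row₀-P = cong 𝟙 (dec-true (P ≟ P) refl)

  row₀-zero : ∀ j → j ≢ 0 → j ≢ P → Larr n 0 j ≡ + 0
  row₀-zero j j≢0 j≢P = cong 𝟙 (cong₂ _∨_ (dec-false (j ≟ 0) j≢0) (dec-false (j ≟ P) j≢P))

  row₁-last : Larr n 1 (suc P) ≡ + 1
  row₁-last = cong 𝟙 (dec-true (P ≟ P) refl)

  row₁-zero : ∀ x → x ≢ 0 → x ≢ 1 → x ≢ suc P → Larr n 1 x ≡ + 0
  row₁-zero x x≢0 x≢1 x≢n-1 = cong 𝟙 (cong₂ _∨_ (dec-false (x ≟ 0) x≢0)
    (cong₂ _∨_ (dec-false (x ≟ 1) x≢1) (dec-false (x ≟ suc P) x≢n-1)))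

  A B : Array
  A = delete (Larr n) 0
  B = delete (Larr n) P

  det-A : det↾ (suc P) A ≡ bandDet P + s * bandᵀDet P
  det-A = begin
    det↾ (suc P) A                                        ≡⟨ det↾-row-0p P A K (ℕ.n<1+n K) refl row₁-last vanish ⟩
    det↾ P (delete A 0) + s * det↾ P (delete A P)         ≡⟨ cong₂ (λ x y → x + s * y)
                                                               (det↾-cong P (λ r c _ _ → Larr-band n r (suc (suc c))))
                                                               (det↾-cong P (λ r c _ c<P → trans (Larr-band n r _) (cong (Bandᵀ r) (punch-below P c c<P)))) ⟩
    bandDet P + s * bandᵀDet P                            ∎
    where
    vanish : ∀ j → j < suc P → j ≢ 0 → j ≢ P → A 0 j ≡ + 0
    vanish j _ j≢0 j≢P = row₁-zero (suc j) (λ ()) (j≢0 ∘ ℕ.suc-injective) (j≢P ∘ ℕ.suc-injective)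

  det-B : det↾ (suc P) B ≡ cappedDet P - cappedDet K + s
  det-B = begin
    det↾ (suc P) B                                                       ≡⟨ det↾-row-01p K B k (ℕ.n<1+n k) refl refl (trans (cong (Larr n 1) (punch-self P)) row₁-last) vanish ⟩
    det↾ P (delete B 0) - det↾ P (delete B 1) + s * det↾ P (delete B P)   ≡⟨ cong₂ (λ x y → x - y + s * det↾ P (delete B P)) minor₀ minor₁ ⟩
    cappedDet P - cappedDet K + s * det↾ P (delete B P)                   ≡⟨ cong (λ x → cappedDet P - cappedDet K + s * x) minorₚ ⟩
    cappedDet P - cappedDet K + s * + 1                                   ≡⟨ cong (λ x → cappedDet P - cappedDet K + x) (ℤ.*-identityʳ s) ⟩
    cappedDet P - cappedDet K + s                                         ∎
    where
    vanish : ∀ j → j < suc P → j ≢ 0 → j ≢ 1 → j ≢ P → B 0 j ≡ + 0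
    vanish j j<P+1 j≢0 j≢1 j≢P = trans (cong (Larr n 1) (punch-below P j j<P)) (row₁-zero j j≢0 j≢1 (ℕ.<⇒≢ (ℕ.m<n⇒m<1+n j<P)))
      where
      j<P : j < P
      j<P = ℕ.≤∧≢⇒< (ℕ.≤-pred j<P+1) j≢P
    B₁ = delete B 1
    minor₀ : det↾ P (delete B 0) ≡ cappedDet P
    minor₀ = det↾-cong P (λ r c r<P c<P → trans (Larr-band n r _) (band-capLast P r c r<P c<P))
    minor₁ : det↾ P B₁ ≡ cappedDet K
    minor₁ = trans (det↾-unitPivot K B₁ refl (λ r → Larr-band n (suc r) 0))
                   (det↾-cong K (λ r c r<K c<K → trans (Larr-band n (suc r) (punch P (suc (suc c)))) (band-capLast K r c r<K c<K)))
    minorₚ : det↾ P (delete B P) ≡ + 1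
    minorₚ = trans (det↾-cong P (λ r c _ c<P → trans (Larr-band n r _) (cong (Band (suc (suc r))) (trans (cong (punch P) (punch-below P c c<P)) (punch-below P c c<P)))))
                   (det↾-UnitUpper P)

  L-expansion : det↾ n (Larr n) ≡ lhsForm (bandDet P) (bandᵀDet P) (cappedDet P) (cappedDet K) s
  L-expansion = begin
    det↾ n (Larr n)                                 ≡⟨ det↾-row-0p (suc P) (Larr n) K (ℕ.m<n⇒m<1+n (ℕ.n<1+n K)) refl row₀-P (λ j _ → row₀-zero j) ⟩
    det↾ (suc P) A + s * det↾ (suc P) B             ≡⟨ cong₂ (λ x y → x + s * y) det-A det-B ⟩
    bandDet P + s * bandᵀDet P + s * (cappedDet P - cappedDet K + s) ∎

C-closed : ∀ m → C m ≡ cycle4 (+ 1) (+ 1) (+ 0) (+ 0) m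
C-closed m = trans (C≡bandDet m) (bandDet-closed m)

-- Once every value is replaced by its 4-periodic closed form, the identity
-- only depends on k mod 4 and is checked in the four cases.
module ClosedForms where
  c cap s : ℕ → ℤ
  c   = cycle4 (+ 1) (+ 1) (+ 0) (+ 0)
  cap = cycle4 (+ 1) (+ 0) (- (+ 1)) (+ 0)
  s   = cycle4 (+ 1) (- (+ 1)) (+ 1) (- (+ 1))

  periodic-identity : ∀ k →
    lhsForm (c k) (c k) (cap (3 +ℕ k)) (cap (2 +ℕ k)) (s k) ≡
    rhsForm (c k) (c (3 +ℕ k)) (c (2 +ℕ k)) (c (1 +ℕ k)) (s (2 +ℕ k))
  periodic-identity = ind4 _ refl refl refl refl (λ _ eq → eq)

open ClosedForms using (periodic-identity)

lemma3 : (n : ℕ) → 6 ≤ n →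
    L n ≡ C (n ∸ 2) * (+ 1 + (- (+ 1)) ^ n)
          + (- (+ 1)) ^ n * (C (n ∸ 3) - + 2 * C (n ∸ 4) + C (n ∸ 5))
          + + 1
lemma3 n@(suc (suc (suc (suc (suc (suc k)))))) (s≤s (s≤s (s≤s (s≤s (s≤s (s≤s z≤n)))))) = begin
  L n
    ≡⟨ L≡det↾ n ⟩
  det↾ n (Larr n)
    ≡⟨ L-expansion ⟩
  lhsForm (bandDet P) (bandᵀDet P) (cappedDet P) (cappedDet K) (sign P)
    ≡⟨ lhsForm-cong (bandDet-closed P) (bandᵀDet-closed P) (cappedDet-closed (3 +ℕ k)) (cappedDet-closed (2 +ℕ k)) (sign-cycle P) ⟩
  _ ≡⟨ periodic-identity k ⟩
  _ ≡⟨ rhsForm-cong (C-closed (n ∸ 2)) (C-closed (n ∸ 3)) (C-closed (n ∸ 4)) (C-closed (n ∸ 5)) (sign-cycle n) ⟨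
  rhsForm (C (n ∸ 2)) (C (n ∸ 3)) (C (n ∸ 4)) (C (n ∸ 5)) (sign n)
    ∎
  where open Expansion (2 +ℕ k) using (K; P; L-expansion)
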